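{- No $(\oplus,\Downarrow,\mathcal{P})$-circuit defines any regressive or semi-regressive function $\mathbb{N}\to\mathbb{N}$.
   Context: $\mathbb{N}=\{0,1,2,\ldots\}$, $2^{\mathbb{N}}$ is its power set. A set-function is a map $(2^{\mathbb{N}})^j\to 2^{\mathbb{N}}$ for some $j\ge 0$. For a collection $\mathcal{C}$ of set-functions, $\mathcal{C}$-circuits are terms built from variables ranging over $2^{\mathbb{N}}$, the constants $\emptyset$, $\mathbb{N}$, $\{n\}$ ($n\in\mathbb{N}$), the operations $\cup$, $\cap$, complement relative to $\mathbb{N}$, and the functions in $\mathcal{C}$; a $(\oplus,\Downarrow,\mathcal{P})$-circuit is a $(\{\oplus,\Downarrow\}\cup\mathcal{P})$-circuit. Here $s\oplus t=\{m+n\mid m\in s,n\in t\}$, $\Downarrow(x)=\{m\in\mathbb{N}\mid\exists n\in x,\ m\le n\}$, and $\mathcal{P}$ is the collection of all set-functions (all arities) whose values all lie in $\{\emptyset,\{0\}\}$. A circuit $\sigma(x)$ defines $f:\mathbb{N}\to\mathbb{N}$ if $\sigma(\{n\})=\{f(n)\}$ for all $n\in\mathbb{N}$. A function $f:\mathbb{N}\to\mathbb{N}$ is regressive if $\{f(n)\mid n\in\mathbb{N},\ f(n)<n\}$ is infinite, and semi-regressive if for every $\ell\ge0$ there is $n\ge0$ with $n+\ell\le f(n)\le 2n-2$. -}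

module Defs where

open import Level using (0ℓ)
open import Data.Nat using (ℕ; _+_; _*_; _≤_; _<_)
open import Data.Fin using (Fin)
open import Data.Product using (Σ; _×_; ∃)
open import Data.Sum using (_⊎_)
open import Data.Empty using (⊥)
open import Data.Unit using (⊤)
open import Relation.Nullary using (¬_)
open import Relation.Binary.PropositionalEquality using (_≡_)

Sub : Set₁
Sub = ℕ → Set

_≐_ : Sub → Sub → Set
s ≐ t = ∀ m → (s m → t m) × (t m → s m)

∅ˢ : Sub
∅ˢ _ = ⊥

ℕˢ : Sub
ℕˢ _ = ⊤

｛_｝ : ℕ → Sub
｛ n ｝ m = m ≡ n

_∪ˢ_ : Sub → Sub → Sub
(s ∪ˢ t) m = s m ⊎ t m

_∩ˢ_ : Sub → Sub → Sub
(s ∩ˢ t) m = s m × t m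

∁ˢ : Sub → Sub
∁ˢ s m = ¬ s m

_⊕_ : Sub → Sub → Sub
(s ⊕ t) m = Σ ℕ λ a → Σ ℕ λ b → s a × t b × (a + b ≡ m)

⇓ : Sub → Sub
⇓ x m = Σ ℕ λ n → x n × (m ≤ n)

-- A member of 𝒫 of arity j: a set-function (2^ℕ)^j → 2^ℕ (i.e. a map
-- respecting set equality) whose values all lie in {∅, {0}}
-- (every value is a subset of {0}).
record PFun (j : ℕ) : Set₁ where
  field
    fun      : (Fin j → Sub) → Sub
    respects : ∀ xs ys → (∀ i → xs i ≐ ys i) → fun xs ≐ fun ys
    into0    : ∀ xs m → fun xs m → m ≡ 0

data Circuit (v : ℕ) : Set₁ where
  var   : Fin v → Circuit v
  empty : Circuit v
  full  : Circuit v
  single : ℕ → Circuit v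
  _∪ᶜ_  : Circuit v → Circuit v → Circuit v
  _∩ᶜ_  : Circuit v → Circuit v → Circuit v
  compl : Circuit v → Circuit v
  _⊕ᶜ_  : Circuit v → Circuit v → Circuit v
  ⇓ᶜ    : Circuit v → Circuit v
  pfun  : (j : ℕ) → PFun j → (Fin j → Circuit v) → Circuit v

⟦_⟧ : ∀ {v} → Circuit v → (Fin v → Sub) → Sub
⟦ var i ⟧ ρ = ρ i
⟦ empty ⟧ ρ = ∅ˢ
⟦ full ⟧ ρ = ℕˢ
⟦ single n ⟧ ρ = ｛ n ｝
⟦ c ∪ᶜ d ⟧ ρ = ⟦ c ⟧ ρ ∪ˢ ⟦ d ⟧ ρ
⟦ c ∩ᶜ d ⟧ ρ = ⟦ c ⟧ ρ ∩ˢ ⟦ d ⟧ ρ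
⟦ compl c ⟧ ρ = ∁ˢ (⟦ c ⟧ ρ)
⟦ c ⊕ᶜ d ⟧ ρ = ⟦ c ⟧ ρ ⊕ ⟦ d ⟧ ρ
⟦ ⇓ᶜ c ⟧ ρ = ⇓ (⟦ c ⟧ ρ)
⟦ pfun j F cs ⟧ ρ = PFun.fun F (λ i → ⟦ cs i ⟧ ρ)

Defines : Circuit 1 → (ℕ → ℕ) → Set
Defines σ f = ∀ n → ⟦ σ ⟧ (λ _ → ｛ n ｝) ≐ ｛ f n ｝

-- { f(n) | f(n) < n } is infinite: it contains elements ≥ k for every k.
Regressive : (ℕ → ℕ) → Set
Regressive f = ∀ k → Σ ℕ λ n → (f n < n) × (k ≤ f n)

-- ∀ ℓ ∃ n, n + ℓ ≤ f(n) ≤ 2n − 2  (the upper bound written f n + 2 ≤ 2n,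
-- avoiding truncated subtraction).
SemiRegressive : (ℕ → ℕ) → Set
SemiRegressive f = ∀ ℓ → Σ ℕ λ n → (n + ℓ ≤ f n) × (f n + 2 ≤ 2 * n)

module Submission where

-- Fix an input n and evaluate circuits with every variable
-- set to {n}.  Call m "near" (for period n and offset K) if
--   a·n − a ≤ m ≤ a·n + K   for some a ≤ m,
-- and "generic" otherwise.  A set S is K-stable if m ∈ S ⇔ m + 1 ∈ S for
-- every K-generic m: away from the multiples of n the set cannot change.
--
-- The near points of offsets K and L add up to near points of offset
-- K + L, and nearness is decidable; this is what lets ⊕ preserve
-- stability (with offset K + L + 1).  The singleton {n}, the constants,
-- the Boolean operations, ⇓ and the {∅,{0}}-valued functions preserve
-- stability as well, so every circuit value ⟦σ⟧ is stable for an offset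
-- read off from σ alone (`circuit-stable`).
--
-- If σ defines f and f(n) = m + 1, then m ∉ ⟦σ⟧ = {f(n)} ∋ m + 1, so m is
-- not generic.  Finally, both regressive and semi-regressive functions
-- have values f(n) = m + 1 with m generic (the escape lemmas), for every
-- offset, which yields the theorem.

open import Defs
open import Data.Nat using (ℕ)
open import Data.Sum using (_⊎_)
open import Relation.Nullary using (¬_)

open import Data.Nat using (zero; suc; _+_; _*_; _⊔_; _≤_; _<_; z≤n; s≤s; _≤?_)
open import Data.Nat.Properties
open import Data.Product using (_×_; _,_; proj₁; proj₂; ∃-syntax)
open import Data.Sum using (inj₁; inj₂; [_,_])
open import Data.Sum.Function.Propositional using (_⊎-⇔_)
open import Data.Product.Function.NonDependent.Propositional using (_×-⇔_)
open import Data.Empty using (⊥-elim)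
open import Data.Unit using (tt)
open import Data.Fin using (Fin)
open import Function using (_∘_; _⇔_; mk⇔; Equivalence)
open import Function.Related.TypeIsomorphisms using (¬-cong-⇔)
open import Relation.Nullary using (Dec; yes; no)
open import Algebra.Properties.CommutativeSemigroup +-commutativeSemigroup using (interchange)
open import Relation.Nullary.Decidable using (_×-dec_)
open import Relation.Binary.PropositionalEquality using (_≡_; refl; sym; trans; cong; subst)

open Equivalence using (to; from)

-- The offset of a circuit: how far above the multiples of n its value
-- may still change.  Constants {k} contribute k, and each ⊕ adds one.
offset : ∀ {v} → Circuit v → ℕ
offset (var i)       = 0
offset empty         = 0
offset full          = 0
offset (single k)    = k
offset (c ∪ᶜ d)      = offset c ⊔ offset d
offset (c ∩ᶜ d)      = offset c ⊔ offset d
offset (compl c)     = offset c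
offset (c ⊕ᶜ d)      = suc (offset c + offset d)
offset (⇓ᶜ c)        = offset c
offset (pfun j F cs) = 0

≤-*-pos : ∀ a {n} → 0 < n → a ≤ a * n
≤-*-pos a {suc n} _ = m≤m*n a (suc n)

module Period (n : ℕ) where

  Near : ℕ → ℕ → Set
  Near K m = ∃[ a ] a < suc m × (a * n ≤ m + a × m ≤ a * n + K)

  Generic : ℕ → ℕ → Set
  Generic K m = ¬ Near K m

  -- The witness a is bounded by m, so nearness is decidable.
  near? : ∀ K m → Dec (Near K m)
  near? K m = anyUpTo? (λ a → (a * n ≤? m + a) ×-dec (m ≤? a * n + K)) (suc m)

  near-mono : ∀ {K K′ m} → K ≤ K′ → Near K m → Near K′ m
  near-mono K≤K′ (a , a≤m , lower , upper) =
    a , a≤m , lower , ≤-trans upper (+-monoʳ-≤ (a * n) K≤K′)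

  generic-mono : ∀ {K K′ m} → K ≤ K′ → Generic K′ m → Generic K m
  generic-mono K≤K′ g = g ∘ near-mono K≤K′

  -- The window of the multiple 0 is [0, K], so generic points exceed K.
  generic⇒offset< : ∀ {K m} → Generic K m → K < m
  generic⇒offset< {K} {m} g with m ≤? K
  ... | yes m≤K = ⊥-elim (g (0 , s≤s z≤n , z≤n , m≤K))
  ... | no m≰K  = ≰⇒> m≰K

  near-+ : ∀ {K L x y} → Near K x → Near L y → Near (K + L) (x + y)
  near-+ {K} {L} {x} {y} (a , s≤s a≤x , aₗ , aᵤ) (b , s≤s b≤y , bₗ , bᵤ) =
    a + b , s≤s (+-mono-≤ a≤x b≤y) , lower , upper
    where
    open ≤-Reasoning
    lower : (a + b) * n ≤ x + y + (a + b)
    lower = begin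
      (a + b) * n         ≡⟨ *-distribʳ-+ n a b ⟩
      a * n + b * n       ≤⟨ +-mono-≤ aₗ bₗ ⟩
      (x + a) + (y + b)   ≡⟨ interchange x a y b ⟩
      x + y + (a + b)     ∎
    upper : x + y ≤ (a + b) * n + (K + L)
    upper = begin
      x + y                       ≤⟨ +-mono-≤ aᵤ bᵤ ⟩
      (a * n + K) + (b * n + L)   ≡⟨ interchange (a * n) K (b * n) L ⟩
      a * n + b * n + (K + L)     ≡⟨ cong (_+ (K + L)) (sym (*-distribʳ-+ n a b)) ⟩
      (a + b) * n + (K + L)       ∎

  near-suc : ∀ {K m} → Near K m → Near (suc K) (suc m)
  near-suc {K} {m} (a , a≤m , lower , upper) =
    a , m≤n⇒m≤1+n a≤m , m≤n⇒m≤1+n lower , ≤-trans (s≤s upper) (≤-reflexive (sym (+-suc (a * n) K)))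

  generic-pred : ∀ {K m} → Generic (suc K) (suc m) → Generic K m
  generic-pred g = g ∘ near-suc

  -- If x + y is generic for K + L, then x is generic for K or y is
  -- generic for L (decidability of nearness makes this constructive).
  generic-split : ∀ {K L x y} → Generic (K + L) (x + y) → Generic K x ⊎ Generic L y
  generic-split {K} {L} {x} {y} g with near? K x | near? L y
  ... | no ¬near-x | _            = inj₁ ¬near-x
  ... | yes near-x | no ¬near-y   = inj₂ ¬near-y
  ... | yes near-x | yes near-y   = ⊥-elim (g (near-+ near-x near-y))

  near-period : ∀ {K m} → 0 < m → m ≤ n → n ≤ suc m → Near K m
  near-period {K} {m} 0<m m≤n n≤1+m =
    1 , s≤s 0<m ,
    subst (_≤ m + 1) (sym (*-identityˡ n)) (≤-trans n≤1+m (≤-reflexive (+-comm 1 m))) ,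
    subst (λ k → m ≤ k + K) (sym (*-identityˡ n)) (≤-trans m≤n (m≤m+n n K))

  Stable : ℕ → Sub → Set
  Stable K S = ∀ m → Generic K m → S m ⇔ S (suc m)

  stable-weaken : ∀ {K K′ S} → K ≤ K′ → Stable K S → Stable K′ S
  stable-weaken K≤K′ stable m g = stable m (generic-mono K≤K′ g)

  -- The singleton {n} only changes at n − 1 and n, which are near points.
  singleton-period-stable : Stable 0 ｛ n ｝
  singleton-period-stable m g = mk⇔
    (λ { refl → ⊥-elim (g (near-period 0<m ≤-refl (n≤1+n m))) })
    (λ { refl → ⊥-elim (g (near-period 0<m (n≤1+n m) ≤-refl)) })
    where
    0<m : 0 < m
    0<m = generic⇒offset< g

  -- A set contained in [0, K] is K-stable: generic points lie above K.
  bounded-stable : ∀ {K S} → (∀ m → S m → m ≤ K) → Stable K S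
  bounded-stable {K} bounded m g = mk⇔
    (λ m∈S → ⊥-elim (<⇒≱ K<m (bounded m m∈S)))
    (λ 1+m∈S → ⊥-elim (<⇒≱ (m<n⇒m<1+n K<m) (bounded (suc m) 1+m∈S)))
    where
    K<m : K < m
    K<m = generic⇒offset< g

  full-stable : Stable 0 ℕˢ
  full-stable m g = mk⇔ (λ _ → tt) (λ _ → tt)

  stable-∪ : ∀ {K S T} → Stable K S → Stable K T → Stable K (S ∪ˢ T)
  stable-∪ stable-S stable-T m g = stable-S m g ⊎-⇔ stable-T m g

  stable-∩ : ∀ {K S T} → Stable K S → Stable K T → Stable K (S ∩ˢ T)
  stable-∩ stable-S stable-T m g = stable-S m g ×-⇔ stable-T m g

  stable-∁ : ∀ {K S} → Stable K S → Stable K (∁ˢ S)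
  stable-∁ stable m g = ¬-cong-⇔ (stable m g)

  -- ⇓ S gains m + 1 only through a witness k = m, which S then shares with m + 1.
  stable-⇓ : ∀ {K S} → Stable K S → Stable K (⇓ S)
  stable-⇓ {S = S} stable m g = mk⇔ up (λ { (k , k∈S , 1+m≤k) → k , k∈S , ≤-trans (n≤1+n m) 1+m≤k })
    where
    up : ⇓ S m → ⇓ S (suc m)
    up (k , k∈S , m≤k) with m≤n⇒m<n∨m≡n m≤k
    ... | inj₁ m<k  = k , k∈S , m<k
    ... | inj₂ refl = suc m , to (stable m g) k∈S , ≤-refl

  module _ {K L S T} (stable-S : Stable K S) (stable-T : Stable L T) where

    -- A sum a + b = m moves right by moving whichever summand is generic.
    ⊕-up : ∀ m → Generic (suc (K + L)) m → (S ⊕ T) m → (S ⊕ T) (suc m)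
    ⊕-up m g (a , b , a∈S , b∈T , a+b≡m)
      with generic-split {K} {L} (subst (Generic (K + L)) (sym a+b≡m) (generic-mono (n≤1+n _) g))
    ... | inj₁ gen-a = suc a , b , to (stable-S a gen-a) a∈S , b∈T , cong suc a+b≡m
    ... | inj₂ gen-b = a , suc b , a∈S , to (stable-T b gen-b) b∈T , trans (+-suc a b) (cong suc a+b≡m)

    -- A sum equal to m + 1 moves left: a zero summand leaves the other
    -- equal to m + 1, and otherwise some positive summand is generic.
    ⊕-down : ∀ m → Generic (suc (K + L)) m → (S ⊕ T) (suc m) → (S ⊕ T) m
    ⊕-down m g (zero , b , 0∈S , b∈T , refl) =
      0 , m , 0∈S , from (stable-T m (generic-mono (≤-trans (m≤n+m L K) (n≤1+n _)) g)) b∈T , refl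
    ⊕-down m g (suc a , zero , 1+a∈S , 0∈T , 1+a+0≡1+m) =
      m , 0 , from (stable-S m (generic-mono (≤-trans (m≤m+n K L) (n≤1+n _)) g)) 1+m∈S , 0∈T , +-identityʳ m
      where
      1+m∈S : S (suc m)
      1+m∈S = subst S (trans (sym (+-identityʳ (suc a))) 1+a+0≡1+m) 1+a∈S
    ⊕-down m g (suc a , suc b , 1+a∈S , 1+b∈T , 2+a+b≡1+m) =
      shift-left (generic-split (generic-pred (subst (Generic (suc (K + L))) (sym 1+a+b≡m) g)))
      where
      1+a+b≡m : suc (a + b) ≡ m
      1+a+b≡m = trans (sym (+-suc a b)) (suc-injective 2+a+b≡1+m)
      shift-left : Generic K a ⊎ Generic L b → (S ⊕ T) m
      shift-left (inj₁ gen-a) =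
        a , suc b , from (stable-S a gen-a) 1+a∈S , 1+b∈T , suc-injective 2+a+b≡1+m
      shift-left (inj₂ gen-b) =
        suc a , b , 1+a∈S , from (stable-T b gen-b) 1+b∈T , 1+a+b≡m

    stable-⊕ : Stable (suc (K + L)) (S ⊕ T)
    stable-⊕ m g = mk⇔ (⊕-up m g) (⊕-down m g)

  circuit-stable : ∀ {v} (ρ : Fin v → Sub) → (∀ i → Stable 0 (ρ i)) →
                   ∀ c → Stable (offset c) (⟦ c ⟧ ρ)
  circuit-stable ρ vars (var i)    = vars i
  circuit-stable ρ vars empty      = bounded-stable (λ _ ())
  circuit-stable ρ vars full       = full-stable
  circuit-stable ρ vars (single k) = bounded-stable (λ { _ refl → ≤-refl })
  circuit-stable ρ vars (c ∪ᶜ d)   =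
    stable-∪ (stable-weaken (m≤m⊔n _ _) (circuit-stable ρ vars c))
             (stable-weaken (m≤n⊔m _ _) (circuit-stable ρ vars d))
  circuit-stable ρ vars (c ∩ᶜ d)   =
    stable-∩ (stable-weaken (m≤m⊔n _ _) (circuit-stable ρ vars c))
             (stable-weaken (m≤n⊔m _ _) (circuit-stable ρ vars d))
  circuit-stable ρ vars (compl c)  = stable-∁ (circuit-stable ρ vars c)
  circuit-stable ρ vars (c ⊕ᶜ d)   = stable-⊕ (circuit-stable ρ vars c) (circuit-stable ρ vars d)
  circuit-stable ρ vars (⇓ᶜ c)     = stable-⇓ (circuit-stable ρ vars c)
  circuit-stable ρ vars (pfun j F cs) =
    bounded-stable (λ m m∈F → ≤-reflexive (PFun.into0 F (λ i → ⟦ cs i ⟧ ρ) m m∈F))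

open Period

Escapes : (ℕ → ℕ) → ℕ → Set
Escapes f K = ∃[ n ] ∃[ m ] f n ≡ suc m × Generic n K m

-- A function defined by σ never escapes the offset of σ: with
-- f(n) = m + 1, stability would put m into ⟦σ⟧({n}) = {m + 1}.
defined-no-escape : ∀ σ f → Defines σ f → ¬ Escapes f (offset σ)
defined-no-escape σ f defines (n , m , fn≡1+m , g) =
  <-irrefl m≡1+m (n<1+n m)
  where
  value : Sub
  value = ⟦ σ ⟧ (λ _ → ｛ n ｝)
  1+m∈value : value (suc m)
  1+m∈value = proj₂ (defines n (suc m)) (sym fn≡1+m)
  m∈value : value m
  m∈value = from (circuit-stable n _ (λ _ → singleton-period-stable n) σ m g) 1+m∈value
  m≡1+m : m ≡ suc m
  m≡1+m = trans (proj₁ (defines n m) m∈value) fn≡1+m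

successor-above : ∀ {k x} → suc k ≤ x → ∃[ m ] x ≡ suc m × k ≤ m
successor-above (s≤s k≤m) = _ , refl , k≤m

-- Below the period, only the window [0, K] of the multiple 0 matters.
regressive-generic : ∀ {n K m} → suc m < n → K < m → Generic n K m
regressive-generic _ K<m (zero , _ , _ , m≤K) = <⇒≱ K<m m≤K
regressive-generic {n} {_} {m} 1+m<n K<m (suc a , _ , lower , _) = <⇒≱ m+1+a<[1+a]n lower
  where
  open ≤-Reasoning
  m+1+a<[1+a]n : m + suc a < suc a * n
  m+1+a<[1+a]n = begin-strict
    m + suc a   ≡⟨ +-suc m a ⟩
    suc m + a   <⟨ +-monoˡ-< a 1+m<n ⟩
    n + a       ≤⟨ +-monoʳ-≤ n (≤-*-pos a (m<n⇒0<n 1+m<n)) ⟩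
    n + a * n   ∎

-- Strictly between n + K and 2n − 2, only the windows of 0 and n matter,
-- and neither reaches that far.
semiregressive-generic : ∀ {n K m} → n + K < m → m + 2 < 2 * n → Generic n K m
semiregressive-generic {n} n+K<m _ (zero , _ , _ , m≤K) = <⇒≱ (≤-<-trans (m≤n+m _ n) n+K<m) m≤K
semiregressive-generic {n} {K} n+K<m _ (suc zero , _ , _ , m≤1n+K) =
  <⇒≱ n+K<m (subst (λ k → _ ≤ k + K) (*-identityˡ n) m≤1n+K)
semiregressive-generic {n} {K} {m} _ m+2<2n (suc (suc a) , _ , lower , _) =
  <⇒≱ m+2+a<[2+a]n lower
  where
  open ≤-Reasoning
  m+2+a<[2+a]n : m + (2 + a) < (2 + a) * n
  m+2+a<[2+a]n = begin-strict
    m + (2 + a)     ≡⟨ sym (+-assoc m 2 a) ⟩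
    m + 2 + a       <⟨ +-monoˡ-< a m+2<2n ⟩
    2 * n + a       ≤⟨ +-monoʳ-≤ (2 * n) (≤-*-pos a 0<n) ⟩
    2 * n + a * n   ≡⟨ sym (*-distribʳ-+ n 2 a) ⟩
    (2 + a) * n     ∎
    where
    0<n : 0 < n
    0<n = n≢0⇒n>0 (λ { refl → <⇒≱ m+2<2n z≤n })

regressive-escapes : ∀ {f} K → Regressive f → Escapes f K
regressive-escapes K regressive =
  let n , fn<n , 2+K≤fn = regressive (2 + K)
      m , fn≡1+m , 1+K≤m = successor-above 2+K≤fn
  in n , m , fn≡1+m , regressive-generic (subst (_< n) fn≡1+m fn<n) 1+K≤m

semiregressive-escapes : ∀ {f} K → SemiRegressive f → Escapes f K
semiregressive-escapes {f} K semiregressive =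
  let n , n+2+K≤fn , fn+2≤2n = semiregressive (2 + K)
      m , fn≡1+m , n+1+K≤m = successor-above (subst (_≤ f n) (+-suc n (suc K)) n+2+K≤fn)
  in n , m , fn≡1+m ,
     semiregressive-generic (subst (_≤ m) (+-suc n K) n+1+K≤m)
                            (subst (λ x → x + 2 ≤ 2 * n) fn≡1+m fn+2≤2n)

theorem8 : (σ : Circuit 1) (f : ℕ → ℕ) → Defines σ f → ¬ (Regressive f ⊎ SemiRegressive f)
theorem8 σ f defines =
  defined-no-escape σ f defines ∘ [ regressive-escapes (offset σ) , semiregressive-escapes (offset σ) ]
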